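{- Let $W_{12}=\{(0,0,0),(0,0,1),(0,1,0),(1,0,0)\}\subseteq\{0,1\}^3$. Then $\Lambda(W_{12},3)=1$ and, for each integer $n\ge 4$, $$\Lambda(W_{12},n)=\frac12\binom n3 2^{n-3}.$$
   Context: The $n$-hypercube $Q_n$ is the graph on $\{0,1\}^n$ in which two binary sequences are adjacent iff they differ in exactly one coordinate. A $d$-subcube of $\{0,1\}^n$ is a set $C\subseteq\{0,1\}^n$ obtained by fixing $n-d$ coordinates and letting the remaining $d$ coordinates vary arbitrarily; equivalently $Q_n[C]\cong Q_d$. For $H\subseteq\{0,1\}^d$ and $S\subseteq\{0,1\}^n$, a $d$-subcube $C$ gives a copy of $H$ in $S$ if there is a graph isomorphism $f$ from $Q_d$ to $Q_n[C]$ with $f(H)=S\cap C$. Let $\Lambda(H,S)$ be the number of $d$-subcubes giving a copy of $H$ in $S$, and $\Lambda(H,n)=\max\{\Lambda(H,S): S\subseteq\{0,1\}^n\}$ for $n\ge d$. -}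

module Defs where

open import Data.Nat using (ℕ; zero; suc; _+_)
open import Data.Bool using (Bool; true; false)
open import Data.Maybe using (Maybe; just; nothing)
open import Data.Vec using (Vec; []; _∷_; lookup)
open import Data.Fin using (Fin)
open import Data.List using (List; length)
open import Data.List.Membership.Propositional using (_∈_)
open import Data.List.Relation.Unary.Unique.Propositional using (Unique)
open import Data.Product using (Σ; ∃; _×_; _,_)
open import Data.Sum using (_⊎_)
open import Function.Bundles using (_⇔_)
open import Relation.Binary.PropositionalEquality using (_≡_)

Vertex : ℕ → Set
Vertex n = Vec Bool n

Subset : ℕ → Set
Subset n = Vertex n → Bool

dist : ∀ {n} → Vertex n → Vertex n → ℕ
dist [] [] = 0
dist (true ∷ x) (true ∷ y) = dist x y
dist (false ∷ x) (false ∷ y) = dist x y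
dist (true ∷ x) (false ∷ y) = suc (dist x y)
dist (false ∷ x) (true ∷ y) = suc (dist x y)

Adj : ∀ {n} → Vertex n → Vertex n → Set
Adj x y = dist x y ≡ 1

-- A subcube pattern: coordinate i is fixed to b (just b) or free (nothing).
Pattern : ℕ → Set
Pattern n = Vec (Maybe Bool) n

free : ∀ {n} → Pattern n → ℕ
free [] = 0
free (nothing ∷ c) = suc (free c)
free (just _ ∷ c) = free c

IsSubcube : ∀ {n} → ℕ → Pattern n → Set
IsSubcube d c = free c ≡ d

InCube : ∀ {n} → Pattern n → Vertex n → Set
InCube c x = ∀ i → (lookup c i ≡ nothing) ⊎ (lookup c i ≡ just (lookup x i))

IsIso : ∀ {d n} → Pattern n → (Vertex d → Vertex n) → Set
IsIso {d} {n} c f =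
    (∀ x → InCube c (f x))
  × (∀ x y → f x ≡ f y → x ≡ y)
  × (∀ y → InCube c y → ∃ λ x → f x ≡ y)
  × (∀ x y → Adj x y ⇔ Adj (f x) (f y))

GivesCopy : ∀ {d n} → Subset d → Subset n → Pattern n → Set
GivesCopy {d} {n} H S c =
  IsSubcube d c ×
  (∃ λ (f : Vertex d → Vertex n) →
      IsIso c f
    × (∀ y → ((S y ≡ true) × InCube c y) ⇔ (∃ λ x → (H x ≡ true) × (f x ≡ y))))

ΛIs : ∀ {d n} → Subset d → Subset n → ℕ → Set
ΛIs {d} {n} H S k =
  Σ (List (Pattern n)) λ L →
    Unique L × (∀ c → (c ∈ L) ⇔ GivesCopy H S c) × (length L ≡ k)

ΛmaxIs : ∀ {d} → Subset d → (n : ℕ) → ℕ → Set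
ΛmaxIs {d} H n v =
    (∀ (S : Subset n) k → ΛIs H S k → k Data.Nat.≤ v)
  × (Σ (Subset n) λ S → ΛIs H S v)

W12 : Subset 3
W12 (false ∷ false ∷ false ∷ []) = true
W12 (false ∷ false ∷ true ∷ []) = true
W12 (false ∷ true ∷ false ∷ []) = true
W12 (true ∷ false ∷ false ∷ []) = true
W12 _ = false

-- A subcube C gives a copy of W₁₂ = {000, 001, 010, 100}, the closed neighbourhood of 000 in Q₃,
-- exactly when S ∩ C is a closed neighbourhood ("star") of C: an isomorphism Q₃ ≅ Q_n[C] preserves
-- distance, so it carries stars to stars, and a translation carries the star at 000 to any other.
-- Upper bound: an exhaustive check shows that at most 4 of the 8 facets of Q₄ are stars. Every 3-cube
-- of Q_n is a facet of exactly n − 3 four-cubes, so double counting gives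
-- (n − 3)·Λ ≤ 4·#(4-cubes) = (n − 3)·#(3-cubes)/2.
-- Lower bound: S₀ = {x : |x| ≡ 0, 1 (mod 4)} meets a 3-cube in a star exactly when an even number of
-- its coordinates are fixed to 1, which holds for half of the 3-cubes once n ≥ 4.

module Submission where

open import Defs
open import Data.Nat using (ℕ; _*_; _∸_; _^_; _≤_)
open import Data.Nat.Combinatorics using (_C_)
open import Data.Product using (_×_; Σ)
open import Relation.Binary.PropositionalEquality using (_≡_)

open import Data.Bool using (Bool; true; false; not; _∧_; _xor_; if_then_else_)
open import Data.Bool.Properties
  using (not-involutive; xor-assoc; xor-same; xor-identityʳ; ∧-conicalˡ; ∧-conicalʳ; ⇔→≡; T-≡)
  renaming (_≟_ to _≟ᵇ_)
open import Data.Fin using () renaming (zero to fzero; suc to fsuc)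
open import Data.List using (List; []; _∷_; _++_; [_]; map; filter; length; drop)
open import Data.List.Membership.Propositional using (_∈_)
open import Data.List.Membership.Propositional.Properties
  using (∈-map⁺; ∈-++⁺ˡ; ∈-++⁺ʳ; ∈-filter⁺; ∈-filter⁻)
open import Data.List.Membership.Propositional.Properties.WithK using (unique∧set⇒bag)
open import Data.List.Properties using (map-++; map-∘; length-filter)
open import Data.List.Relation.Binary.BagAndSetEquality using (∼bag⇒↭)
open import Data.List.Relation.Binary.Disjoint.Propositional using (Disjoint)
open import Data.List.Relation.Binary.Permutation.Propositional.Properties using (↭-length)
open import Data.List.Relation.Unary.All as All using (All; []; _∷_)
import Data.List.Relation.Unary.All.Properties as All
import Data.List.Relation.Unary.AllPairs as AllPairs
open import Data.List.Relation.Unary.Any using (here)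
open import Data.List.Relation.Unary.Unique.Propositional using (Unique)
import Data.List.Relation.Unary.Unique.Propositional.Properties as Unique
open import Data.Maybe using (Maybe; just; nothing; maybe; is-just)
open import Data.Nat using (zero; suc; _+_; _<_; _≤ᵇ_; _%_; s≤s; z≤n; >-nonZero)
open import Data.Nat.Combinatorics using (nCk+nC[k+1]≡[n+1]C[k+1])
open import Data.Nat.Combinatorics.Specification using (k>n⇒nCk≡0)
open import Data.Nat.DivMod using ([m+n]%n≡m%n)
open import Data.Nat.ListAction using (sum)
open import Data.Nat.ListAction.Properties using (sum-++)
open import Data.Nat.Properties
  using (_<?_; ≮⇒≥; ≤ᵇ⇒≤; suc-injective; m<n⇒m<1+n; m<n⇒0<n∸m;
         +-comm; +-suc; +-identityʳ; +-∸-assoc; +-mono-≤; +-commutativeSemigroup;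
         *-suc; *-zeroʳ; *-distribˡ-+; *-distribʳ-+; *-monoʳ-≤; *-cancelˡ-≤; module ≤-Reasoning)
open import Algebra.Properties.CommutativeSemigroup +-commutativeSemigroup using (interchange)
open import Data.Nat.Tactic.RingSolver using (solve-∀)
open import Data.Product using (_,_; proj₁; ∃)
open import Data.Sum using (inj₁; inj₂)
open import Data.Vec using ([]; _∷_; head; zipWith; replicate; toList)
open import Data.Vec.Properties using (∷-injectiveʳ)
open import Function using (_∘_; id)
open import Function.Bundles using (_⇔_; mk⇔; Equivalence)
open import Relation.Nullary using (¬_; yes; no)
open import Relation.Nullary.Decidable using (⌊_⌋; toWitness)
open import Relation.Binary.PropositionalEquality
  using (refl; sym; trans; cong; cong₂; subst; _≢_; _≗_; module ≡-Reasoning)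

-- Distance and stars

_⊕_ : ∀ {n} → Vertex n → Vertex n → Vertex n
_⊕_ = zipWith _xor_

origin : ∀ {n} → Vertex n
origin = replicate _ false

ball : ∀ {n} → Vertex n → Subset n
ball v x = dist v x ≤ᵇ 1

dist-refl : ∀ {n} (x : Vertex n) → dist x x ≡ 0
dist-refl []          = refl
dist-refl (true ∷ x)  = dist-refl x
dist-refl (false ∷ x) = dist-refl x

dist≡0⇒≡ : ∀ {n} {x y : Vertex n} → dist x y ≡ 0 → x ≡ y
dist≡0⇒≡ {x = []}        {[]}        _  = refl
dist≡0⇒≡ {x = true ∷ x}  {true ∷ y}  eq = cong (true ∷_) (dist≡0⇒≡ eq)
dist≡0⇒≡ {x = false ∷ x} {false ∷ y} eq = cong (false ∷_) (dist≡0⇒≡ eq)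

dist-cong-∷ : ∀ {m n} a b {x y : Vertex m} {x′ y′ : Vertex n} → dist x y ≡ dist x′ y′ →
              dist (a ∷ x) (b ∷ y) ≡ dist (a ∷ x′) (b ∷ y′)
dist-cong-∷ true  true  eq = eq
dist-cong-∷ true  false eq = cong suc eq
dist-cong-∷ false true  eq = cong suc eq
dist-cong-∷ false false eq = eq

dist-⊕ : ∀ {n} (x y v : Vertex n) → dist (x ⊕ v) (y ⊕ v) ≡ dist x y
dist-⊕ []          []          []          = refl
dist-⊕ (true ∷ x)  (true ∷ y)  (true ∷ v)  = dist-⊕ x y v
dist-⊕ (true ∷ x)  (true ∷ y)  (false ∷ v) = dist-⊕ x y v
dist-⊕ (false ∷ x) (false ∷ y) (true ∷ v)  = dist-⊕ x y v
dist-⊕ (false ∷ x) (false ∷ y) (false ∷ v) = dist-⊕ x y v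
dist-⊕ (true ∷ x)  (false ∷ y) (true ∷ v)  = cong suc (dist-⊕ x y v)
dist-⊕ (true ∷ x)  (false ∷ y) (false ∷ v) = cong suc (dist-⊕ x y v)
dist-⊕ (false ∷ x) (true ∷ y)  (true ∷ v)  = cong suc (dist-⊕ x y v)
dist-⊕ (false ∷ x) (true ∷ y)  (false ∷ v) = cong suc (dist-⊕ x y v)

⊕-cancelʳ : ∀ {n} (x v : Vertex n) → (x ⊕ v) ⊕ v ≡ x
⊕-cancelʳ []      []      = refl
⊕-cancelʳ (a ∷ x) (c ∷ v) = cong₂ _∷_ xor-cancelʳ (⊕-cancelʳ x v)
  where
  xor-cancelʳ : (a xor c) xor c ≡ a
  xor-cancelʳ = trans (xor-assoc a c c) (trans (cong (a xor_) (xor-same c)) (xor-identityʳ a))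

origin-⊕ : ∀ {n} (v : Vertex n) → origin ⊕ v ≡ v
origin-⊕ []      = refl
origin-⊕ (c ∷ v) = cong (c ∷_) (origin-⊕ v)

ball-⊕ : ∀ {n} (x y v : Vertex n) → ball (x ⊕ v) (y ⊕ v) ≡ ball x y
ball-⊕ x y v = cong (_≤ᵇ 1) (dist-⊕ x y v)

dist≡0⇔≡ : ∀ {n} {x y : Vertex n} → dist x y ≡ 0 ⇔ x ≡ y
dist≡0⇔≡ {x = x} = mk⇔ dist≡0⇒≡ (λ { refl → dist-refl x })

≤ᵇ1-cong : ∀ {m n} → (m ≡ 0 ⇔ n ≡ 0) → (m ≡ 1 ⇔ n ≡ 1) → (m ≤ᵇ 1) ≡ (n ≤ᵇ 1)
≤ᵇ1-cong {0}           zeros _    with refl ← Equivalence.to zeros refl = refl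
≤ᵇ1-cong {1}           _     ones with refl ← Equivalence.to ones refl = refl
≤ᵇ1-cong {suc (suc m)} {0} zeros _ with () ← Equivalence.from zeros refl
≤ᵇ1-cong {suc (suc m)} {1} _ ones with () ← Equivalence.from ones refl
≤ᵇ1-cong {suc (suc m)} {suc (suc n)} _ _ = refl

ball-invariant : ∀ {d} (g : Vertex d → Vertex d) → (∀ x y → g x ≡ g y → x ≡ y) →
                 (∀ x y → Adj x y ⇔ Adj (g x) (g y)) → ∀ x y → ball (g x) (g y) ≡ ball x y
ball-invariant g g-inj g-adj x y = ≤ᵇ1-cong
  (mk⇔ (λ gx≡gy → Equivalence.from dist≡0⇔≡ (g-inj x y (Equivalence.to dist≡0⇔≡ gx≡gy)))
       (λ x≡y → Equivalence.from dist≡0⇔≡ (cong g (Equivalence.to dist≡0⇔≡ x≡y))))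
  (mk⇔ (Equivalence.from (g-adj x y)) (Equivalence.to (g-adj x y)))

-- Coordinates on a subcube

-- The free coordinates of a subcube are read from a list, left to right;
-- an exhausted list reads as false.

headᶠ : List Bool → Bool
headᶠ []      = false
headᶠ (b ∷ _) = b

fill : ∀ {n} → Pattern n → List Bool → Vertex n
fill []            xs = []
fill (just b ∷ c)  xs = b ∷ fill c xs
fill (nothing ∷ c) xs = headᶠ xs ∷ fill c (drop 1 xs)

freeCoords : ∀ {n} → Pattern n → Vertex n → List Bool
freeCoords []            []      = []
freeCoords (just _ ∷ c)  (_ ∷ y) = freeCoords c y
freeCoords (nothing ∷ c) (b ∷ y) = b ∷ freeCoords c y

toVertex : ∀ d → List Bool → Vertex d
toVertex zero    xs = []
toVertex (suc d) xs = headᶠ xs ∷ toVertex d (drop 1 xs)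

embed : ∀ {n d} → Pattern n → Vertex d → Vertex n
embed c x = fill c (toList x)

coords : ∀ {n d} → Pattern n → Vertex n → Vertex d
coords c y = toVertex _ (freeCoords c y)

toVertex-toList : ∀ {d} (x : Vertex d) → toVertex d (toList x) ≡ x
toVertex-toList []      = refl
toVertex-toList (b ∷ x) = cong (b ∷_) (toVertex-toList x)

toList-toVertex : ∀ {d} (xs : List Bool) → length xs ≡ d → toList (toVertex d xs) ≡ xs
toList-toVertex []       refl = refl
toList-toVertex (b ∷ xs) refl = cong (b ∷_) (toList-toVertex xs refl)

length-freeCoords : ∀ {n} (c : Pattern n) y → length (freeCoords c y) ≡ free c
length-freeCoords []            []      = refl
length-freeCoords (just _ ∷ c)  (_ ∷ y) = length-freeCoords c y
length-freeCoords (nothing ∷ c) (_ ∷ y) = cong suc (length-freeCoords c y)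

freeCoords-fill : ∀ {n} (c : Pattern n) xs → freeCoords c (fill c xs) ≡ toList (toVertex (free c) xs)
freeCoords-fill []            xs = refl
freeCoords-fill (just _ ∷ c)  xs = freeCoords-fill c xs
freeCoords-fill (nothing ∷ c) xs = cong (headᶠ xs ∷_) (freeCoords-fill c (drop 1 xs))

fill-freeCoords : ∀ {n} (c : Pattern n) y → InCube c y → fill c (freeCoords c y) ≡ y
fill-freeCoords []            []      _   = refl
fill-freeCoords (just b ∷ c)  (a ∷ y) y∈c with y∈c fzero
... | inj₂ refl = cong (a ∷_) (fill-freeCoords c y (y∈c ∘ fsuc))
fill-freeCoords (nothing ∷ c) (a ∷ y) y∈c = cong (a ∷_) (fill-freeCoords c y (y∈c ∘ fsuc))

fill-InCube : ∀ {n} (c : Pattern n) xs → InCube c (fill c xs)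
fill-InCube (just b ∷ c)  xs fzero    = inj₂ refl
fill-InCube (just b ∷ c)  xs (fsuc i) = fill-InCube c xs i
fill-InCube (nothing ∷ c) xs fzero    = inj₁ refl
fill-InCube (nothing ∷ c) xs (fsuc i) = fill-InCube c (drop 1 xs) i

coords-embed : ∀ {n d} (c : Pattern n) → IsSubcube d c → (x : Vertex d) → coords c (embed c x) ≡ x
coords-embed c refl x = begin
  toVertex (free c) (freeCoords c (fill c (toList x)))
    ≡⟨ cong (toVertex (free c)) (freeCoords-fill c (toList x)) ⟩
  toVertex (free c) (toList (toVertex (free c) (toList x)))
    ≡⟨ toVertex-toList _ ⟩
  toVertex (free c) (toList x)
    ≡⟨ toVertex-toList x ⟩
  x ∎
  where open ≡-Reasoning

embed-coords : ∀ {n d} (c : Pattern n) → IsSubcube d c → ∀ y → InCube c y →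
               embed c (coords {d = d} c y) ≡ y
embed-coords c refl y y∈c =
  trans (cong (fill c) (toList-toVertex _ (length-freeCoords c y))) (fill-freeCoords c y y∈c)

dist-embed : ∀ {n d} (c : Pattern n) → IsSubcube d c → (x y : Vertex d) →
             dist (embed c x) (embed c y) ≡ dist x y
dist-embed c refl = go c
  where
  go : ∀ {n} (c : Pattern n) (x y : Vertex (free c)) → dist (embed c x) (embed c y) ≡ dist x y
  go []                []      []      = refl
  go (just true ∷ c)   x       y       = go c x y
  go (just false ∷ c)  x       y       = go c x y
  go (nothing ∷ c)     (a ∷ x) (b ∷ y) = dist-cong-∷ a b (go c x y)

-- Copies of a star

restrict : ∀ {n d} → Subset n → Pattern n → Subset d
restrict S c = S ∘ embed c

IsCopyVia : ∀ {d n} → Subset d → Subset n → Pattern n → (Vertex d → Vertex n) → Set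
IsCopyVia H S c f = ∀ y → ((S y ≡ true) × InCube c y) ⇔ (∃ λ x → (H x ≡ true) × (f x ≡ y))

IsCopyVia⇔pullback : ∀ {d n} {H : Subset d} {S : Subset n} {c f} → IsIso c f →
                     IsCopyVia H S c f ⇔ (∀ x → S (f x) ≡ H x)
IsCopyVia⇔pullback {H = H} {S} {c} {f} (f-in , f-inj , f-onto , _) = mk⇔ pullback copy
  where
  pullback : IsCopyVia H S c f → ∀ x → S (f x) ≡ H x
  pullback copy x = ⇔→≡ (mk⇔ from-S from-H)
    where
    from-S : S (f x) ≡ true → H x ≡ true
    from-S Sfx with x′ , Hx′ , fx′≡fx ← Equivalence.to (copy (f x)) (Sfx , f-in x) =
      subst (λ z → H z ≡ true) (f-inj x′ x fx′≡fx) Hx′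
    from-H : H x ≡ true → S (f x) ≡ true
    from-H Hx = proj₁ (Equivalence.from (copy (f x)) (x , Hx , refl))
  copy : (∀ x → S (f x) ≡ H x) → IsCopyVia H S c f
  copy S∘f≗H y = mk⇔ to from
    where
    to : (S y ≡ true) × InCube c y → ∃ λ x → (H x ≡ true) × (f x ≡ y)
    to (Sy , y∈c) with x , refl ← f-onto y y∈c = x , trans (sym (S∘f≗H x)) Sy , refl
    from : (∃ λ x → (H x ≡ true) × (f x ≡ y)) → (S y ≡ true) × InCube c y
    from (x , Hx , refl) = trans (S∘f≗H x) Hx , f-in x

module _ {n d} {c : Pattern n} (c-d : IsSubcube d c) where

  translate-IsIso : ∀ v → IsIso c (λ (x : Vertex d) → embed c (x ⊕ v))
  translate-IsIso v = (λ x → fill-InCube c (toList (x ⊕ v))) , injective , onto , adjacency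
    where
    injective : ∀ x y → embed c (x ⊕ v) ≡ embed c (y ⊕ v) → x ≡ y
    injective x y eq = begin
      x                          ≡⟨ ⊕-cancelʳ x v ⟨
      (x ⊕ v) ⊕ v                ≡⟨ cong (_⊕ v) (coords-embed c c-d (x ⊕ v)) ⟨
      coords c (embed c (x ⊕ v)) ⊕ v ≡⟨ cong (λ z → coords c z ⊕ v) eq ⟩
      coords c (embed c (y ⊕ v)) ⊕ v ≡⟨ cong (_⊕ v) (coords-embed c c-d (y ⊕ v)) ⟩
      (y ⊕ v) ⊕ v                ≡⟨ ⊕-cancelʳ y v ⟩
      y                          ∎
      where open ≡-Reasoning
    onto : ∀ y → InCube c y → ∃ λ x → embed c (x ⊕ v) ≡ y
    onto y y∈c =
      coords c y ⊕ v , trans (cong (embed c) (⊕-cancelʳ (coords c y) v)) (embed-coords c c-d y y∈c)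
    adjacency : ∀ x y → Adj x y ⇔ Adj (embed c (x ⊕ v)) (embed c (y ⊕ v))
    adjacency x y = mk⇔ (trans same-dist) (trans (sym same-dist))
      where
      same-dist : dist (embed c (x ⊕ v)) (embed c (y ⊕ v)) ≡ dist x y
      same-dist = trans (dist-embed c c-d (x ⊕ v) (y ⊕ v)) (dist-⊕ x y v)

  translate-pullback : ∀ {S : Subset n} {v : Vertex d} → restrict S c ≗ ball v →
                       ∀ x → S (embed c (x ⊕ v)) ≡ ball origin x
  translate-pullback {S} {v} S≗ball x = begin
    S (embed c (x ⊕ v))           ≡⟨ S≗ball (x ⊕ v) ⟩
    ball v (x ⊕ v)                ≡⟨ cong (λ z → ball z (x ⊕ v)) (origin-⊕ v) ⟨
    ball (origin ⊕ v) (x ⊕ v)     ≡⟨ ball-⊕ origin x v ⟩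
    ball origin x                 ∎
    where open ≡-Reasoning

  pullback-star : ∀ {S : Subset n} {f} → IsIso c f → (∀ x → S (f x) ≡ ball origin x) →
                  ∃ λ v → restrict S c ≗ ball v
  pullback-star {S} {f} (f-in , f-inj , f-onto , f-adj) S∘f≗ball = g origin , restrict≗ball
    where
    g : Vertex d → Vertex d
    g = coords c ∘ f
    f≡embed∘g : ∀ x → f x ≡ embed c (g x)
    f≡embed∘g x = sym (embed-coords c c-d (f x) (f-in x))
    g-inj : ∀ x y → g x ≡ g y → x ≡ y
    g-inj x y eq = f-inj x y (trans (f≡embed∘g x) (trans (cong (embed c) eq) (sym (f≡embed∘g y))))
    g-adj : ∀ x y → Adj x y ⇔ Adj (g x) (g y)
    g-adj x y = mk⇔ (λ adj → trans same-dist (Equivalence.to (f-adj x y) adj))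
                    (λ adj → Equivalence.from (f-adj x y) (trans (sym same-dist) adj))
      where
      same-dist : dist (g x) (g y) ≡ dist (f x) (f y)
      same-dist = sym (trans (cong₂ dist (f≡embed∘g x) (f≡embed∘g y)) (dist-embed c c-d (g x) (g y)))
    restrict≗ball : ∀ p → S (embed c p) ≡ ball (g origin) p
    restrict≗ball p with x , fx≡ ← f-onto (embed c p) (fill-InCube c (toList p)) = begin
      S (embed c p)          ≡⟨ cong S fx≡ ⟨
      S (f x)                ≡⟨ S∘f≗ball x ⟩
      ball origin x          ≡⟨ ball-invariant g g-inj g-adj origin x ⟨
      ball (g origin) (g x)  ≡⟨ cong (ball (g origin) ∘ coords c) fx≡ ⟩
      ball (g origin) (coords c (embed c p))
                             ≡⟨ cong (ball (g origin)) (coords-embed c c-d p) ⟩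
      ball (g origin) p      ∎
      where open ≡-Reasoning

copy-of-star⇔ : ∀ {d n} {H : Subset d} {S : Subset n} {c} → H ≗ ball origin →
                GivesCopy H S c ⇔ (IsSubcube d c × ∃ λ v → restrict S c ≗ ball v)
copy-of-star⇔ {H = H} {S} {c} H≗ball = mk⇔ to from
  where
  to : GivesCopy H S c → IsSubcube _ c × ∃ λ v → restrict S c ≗ ball v
  to (c-d , f , iso , copy) = c-d , pullback-star c-d {S = S} iso λ x →
    trans (Equivalence.to (IsCopyVia⇔pullback {H = H} {S} {c} iso) copy x) (H≗ball x)
  from : IsSubcube _ c × (∃ λ v → restrict S c ≗ ball v) → GivesCopy H S c
  from (c-d , v , S≗ball) = c-d , _ , iso ,
    Equivalence.from (IsCopyVia⇔pullback {H = H} {S} {c} iso) λ x →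
      trans (translate-pullback c-d {S = S} S≗ball x) (sym (H≗ball x))
    where iso = translate-IsIso c-d v

-- Deciding stars in Q₃

data Table : ℕ → Set where
  leaf : Bool → Table 0
  node : ∀ {n} → Table n → Table n → Table (suc n)

tabulate : ∀ {n} → Subset n → Table n
tabulate {zero}  U = leaf (U [])
tabulate {suc n} U = node (tabulate (U ∘ (false ∷_))) (tabulate (U ∘ (true ∷_)))

lookupᵀ : ∀ {n} → Table n → Subset n
lookupᵀ (leaf b)   []          = b
lookupᵀ (node t _) (false ∷ x) = lookupᵀ t x
lookupᵀ (node _ t) (true ∷ x)  = lookupᵀ t x

tabulate-cong : ∀ {n} {U V : Subset n} → U ≗ V → tabulate U ≡ tabulate V
tabulate-cong {zero}  U≗V = cong leaf (U≗V [])
tabulate-cong {suc n} U≗V =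
  cong₂ node (tabulate-cong (U≗V ∘ (false ∷_))) (tabulate-cong (U≗V ∘ (true ∷_)))

allVertices : ∀ n → (Vertex n → Bool) → Bool
allVertices zero    P = P []
allVertices (suc n) P = allVertices n (P ∘ (false ∷_)) ∧ allVertices n (P ∘ (true ∷_))

allVertices-sound : ∀ n {P} → allVertices n P ≡ true → ∀ x → P x ≡ true
allVertices-sound zero    all []          = all
allVertices-sound (suc n) all (false ∷ x) = allVertices-sound n (∧-conicalˡ _ _ all) x
allVertices-sound (suc n) all (true ∷ x)  = allVertices-sound n (∧-conicalʳ _ _ all) x

allTables : ∀ n → (Table n → Bool) → Bool
allTables zero    P = P (leaf false) ∧ P (leaf true)
allTables (suc n) P = allTables n λ l → allTables n λ r → P (node l r)

allTables-sound : ∀ n {P} → allTables n P ≡ true → ∀ t → P t ≡ true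
allTables-sound zero    all (leaf false) = ∧-conicalˡ _ _ all
allTables-sound zero    all (leaf true)  = ∧-conicalʳ _ _ all
allTables-sound (suc n) all (node l r)   = allTables-sound n (allTables-sound n all l) r

pattern table₃ b₀ b₁ b₂ b₃ b₄ b₅ b₆ b₇ =
  node (node (node (leaf b₀) (leaf b₁)) (node (leaf b₂) (leaf b₃)))
       (node (node (leaf b₄) (leaf b₅)) (node (leaf b₆) (leaf b₇)))

-- The eight stars of Q₃, as truth tables in lexicographic order of the vertices.
centreᵀ : Table 3 → Maybe (Vertex 3)
centreᵀ (table₃ true  true  true  false true  false false false) = just (false ∷ false ∷ false ∷ [])
centreᵀ (table₃ true  true  false true  false true  false false) = just (false ∷ false ∷ true  ∷ [])
centreᵀ (table₃ true  false true  true  false false true  false) = just (false ∷ true  ∷ false ∷ [])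
centreᵀ (table₃ false true  true  true  false false false true ) = just (false ∷ true  ∷ true  ∷ [])
centreᵀ (table₃ true  false false false true  true  true  false) = just (true  ∷ false ∷ false ∷ [])
centreᵀ (table₃ false true  false false true  true  false true ) = just (true  ∷ false ∷ true  ∷ [])
centreᵀ (table₃ false false true  false true  false true  true ) = just (true  ∷ true  ∷ false ∷ [])
centreᵀ (table₃ false false false true  false true  true  true ) = just (true  ∷ true  ∷ true  ∷ [])
centreᵀ _                                                       = nothing

centre : Subset 3 → Maybe (Vertex 3)
centre = centreᵀ ∘ tabulate

isStar : Subset 3 → Bool
isStar = is-just ∘ centre

isStar-cong : ∀ {U V} → U ≗ V → isStar U ≡ isStar V
isStar-cong U≗V = cong (is-just ∘ centreᵀ) (tabulate-cong U≗V)

centre-ball : ∀ v → centre (ball v) ≡ just v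
centre-ball (false ∷ false ∷ false ∷ []) = refl
centre-ball (false ∷ false ∷ true  ∷ []) = refl
centre-ball (false ∷ true  ∷ false ∷ []) = refl
centre-ball (false ∷ true  ∷ true  ∷ []) = refl
centre-ball (true  ∷ false ∷ false ∷ []) = refl
centre-ball (true  ∷ false ∷ true  ∷ []) = refl
centre-ball (true  ∷ true  ∷ false ∷ []) = refl
centre-ball (true  ∷ true  ∷ true  ∷ []) = refl

agreesWithBall : Subset 3 → Vertex 3 → Bool
agreesWithBall U v = allVertices 3 λ x → ⌊ U x ≟ᵇ ball v x ⌋

centreCorrect : Subset 3 → Bool
centreCorrect U = maybe (agreesWithBall U) true (centre U)

-- Checked on all 2⁸ tables; the instance at tabulate U is definitionally the one at U,
-- since centreCorrect only inspects U at the eight vertices.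
centreCorrect-all : ∀ U → centreCorrect U ≡ true
centreCorrect-all U = allTables-sound 3 {centreCorrect ∘ lookupᵀ} refl (tabulate U)

centre-sound : ∀ {U v} → centre U ≡ just v → U ≗ ball v
centre-sound {U} {v} eq x =
  toWitness (Equivalence.from T-≡ (allVertices-sound 3 {λ x → ⌊ U x ≟ᵇ ball v x ⌋} agrees x))
  where
  agrees : agreesWithBall U v ≡ true
  agrees = subst (λ m → maybe (agreesWithBall U) true m ≡ true) eq (centreCorrect-all U)

isStar⇔ : ∀ {U} → isStar U ≡ true ⇔ ∃ λ v → U ≗ ball v
isStar⇔ {U} = mk⇔ to λ (v , U≗ball) → trans (isStar-cong U≗ball) (cong is-just (centre-ball v))
  where
  to : isStar U ≡ true → ∃ λ v → U ≗ ball v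
  to star with centre U in eq
  ... | just v = v , centre-sound eq

W12≗ball : W12 ≗ ball origin
W12≗ball (false ∷ false ∷ false ∷ []) = refl
W12≗ball (false ∷ false ∷ true  ∷ []) = refl
W12≗ball (false ∷ true  ∷ false ∷ []) = refl
W12≗ball (false ∷ true  ∷ true  ∷ []) = refl
W12≗ball (true  ∷ false ∷ false ∷ []) = refl
W12≗ball (true  ∷ false ∷ true  ∷ []) = refl
W12≗ball (true  ∷ true  ∷ false ∷ []) = refl
W12≗ball (true  ∷ true  ∷ true  ∷ []) = refl

GivesCopy-W12⇔ : ∀ {n} {S : Subset n} {c} →
                 GivesCopy W12 S c ⇔ (IsSubcube 3 c × isStar (restrict S c) ≡ true)
GivesCopy-W12⇔ = mk⇔
  (λ copy → let c-3 , star = Equivalence.to (copy-of-star⇔ W12≗ball) copy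
            in c-3 , Equivalence.from isStar⇔ star)
  (λ (c-3 , star) → Equivalence.from (copy-of-star⇔ W12≗ball) (c-3 , Equivalence.to isStar⇔ star))

-- Counting subcubes

fix₀ fix₁ vary : ∀ {n} → Pattern n → Pattern (suc n)
fix₀ = just false ∷_
fix₁ = just true ∷_
vary = nothing ∷_

cubes : ∀ n → ℕ → List (Pattern n)
cubes zero    zero    = [ [] ]
cubes zero    (suc k) = []
cubes (suc n) zero    = map fix₀ (cubes n zero) ++ map fix₁ (cubes n zero)
cubes (suc n) (suc k) = (map fix₀ (cubes n (suc k)) ++ map fix₁ (cubes n (suc k)))
                        ++ map vary (cubes n k)

cubeSum : ∀ n → ℕ → (Pattern n → ℕ) → ℕ
cubeSum zero    zero    w = w []
cubeSum zero    (suc k) w = 0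
cubeSum (suc n) zero    w = cubeSum n zero (w ∘ fix₀) + cubeSum n zero (w ∘ fix₁)
cubeSum (suc n) (suc k) w = cubeSum n (suc k) (w ∘ fix₀) + cubeSum n (suc k) (w ∘ fix₁)
                            + cubeSum n k (w ∘ vary)

cubeSum-cong : ∀ n k {v w : Pattern n → ℕ} → (∀ c → free c ≡ k → v c ≡ w c) →
               cubeSum n k v ≡ cubeSum n k w
cubeSum-cong zero    zero    v≗w = v≗w [] refl
cubeSum-cong zero    (suc k) v≗w = refl
cubeSum-cong (suc n) zero    v≗w =
  cong₂ _+_ (cubeSum-cong n zero (v≗w ∘ fix₀)) (cubeSum-cong n zero (v≗w ∘ fix₁))
cubeSum-cong (suc n) (suc k) v≗w =
  cong₂ _+_ (cong₂ _+_ (cubeSum-cong n (suc k) (v≗w ∘ fix₀)) (cubeSum-cong n (suc k) (v≗w ∘ fix₁)))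
            (cubeSum-cong n k (λ c → v≗w (nothing ∷ c) ∘ cong suc))

cubeSum-mono : ∀ n k {v w : Pattern n → ℕ} → (∀ c → free c ≡ k → v c ≤ w c) →
               cubeSum n k v ≤ cubeSum n k w
cubeSum-mono zero    zero    v≤w = v≤w [] refl
cubeSum-mono zero    (suc k) v≤w = z≤n
cubeSum-mono (suc n) zero    v≤w =
  +-mono-≤ (cubeSum-mono n zero (v≤w ∘ fix₀)) (cubeSum-mono n zero (v≤w ∘ fix₁))
cubeSum-mono (suc n) (suc k) v≤w =
  +-mono-≤ (+-mono-≤ (cubeSum-mono n (suc k) (v≤w ∘ fix₀)) (cubeSum-mono n (suc k) (v≤w ∘ fix₁)))
           (cubeSum-mono n k (λ c → v≤w (nothing ∷ c) ∘ cong suc))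

cubeSum-+ : ∀ n k (v w : Pattern n → ℕ) →
            cubeSum n k (λ c → v c + w c) ≡ cubeSum n k v + cubeSum n k w
cubeSum-+ zero    zero    v w = refl
cubeSum-+ zero    (suc k) v w = refl
cubeSum-+ (suc n) zero    v w =
  trans (cong₂ _+_ (cubeSum-+ n zero (v ∘ fix₀) (w ∘ fix₀))
                   (cubeSum-+ n zero (v ∘ fix₁) (w ∘ fix₁)))
        (interchange (cubeSum n zero (v ∘ fix₀)) (cubeSum n zero (w ∘ fix₀))
                     (cubeSum n zero (v ∘ fix₁)) (cubeSum n zero (w ∘ fix₁)))
cubeSum-+ (suc n) (suc k) v w =
  trans (cong₂ _+_ (cong₂ _+_ (cubeSum-+ n (suc k) (v ∘ fix₀) (w ∘ fix₀))
                              (cubeSum-+ n (suc k) (v ∘ fix₁) (w ∘ fix₁)))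
                   (cubeSum-+ n k (v ∘ vary) (w ∘ vary)))
        (regroup (cubeSum n (suc k) (v ∘ fix₀)) (cubeSum n (suc k) (w ∘ fix₀))
                 (cubeSum n (suc k) (v ∘ fix₁)) (cubeSum n (suc k) (w ∘ fix₁))
                 (cubeSum n k (v ∘ vary)) (cubeSum n k (w ∘ vary)))
  where
  regroup : ∀ a a′ b b′ c c′ → a + a′ + (b + b′) + (c + c′) ≡ a + b + c + (a′ + b′ + c′)
  regroup = solve-∀

cubeSum-* : ∀ n k m (w : Pattern n → ℕ) → cubeSum n k (λ c → m * w c) ≡ m * cubeSum n k w
cubeSum-* zero    zero    m w = refl
cubeSum-* zero    (suc k) m w = sym (*-zeroʳ m)
cubeSum-* (suc n) zero    m w =
  trans (cong₂ _+_ (cubeSum-* n zero m _) (cubeSum-* n zero m _)) (sym (*-distribˡ-+ m _ _))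
cubeSum-* (suc n) (suc k) m w =
  trans (cong₂ _+_ (cong₂ _+_ (cubeSum-* n (suc k) m _) (cubeSum-* n (suc k) m _)) (cubeSum-* n k m _))
        (trans (cong (_+ m * cubeSum n k (w ∘ vary)) (sym (*-distribˡ-+ m _ _)))
               (sym (*-distribˡ-+ m _ _)))

cubeSum-empty : ∀ n k (w : Pattern n → ℕ) → n < k → cubeSum n k w ≡ 0
cubeSum-empty zero    (suc k) w n<k       = refl
cubeSum-empty (suc n) (suc k) w (s≤s n<k) =
  cong₂ _+_ (cong₂ _+_ (cubeSum-empty n (suc k) _ n<1+k) (cubeSum-empty n (suc k) _ n<1+k))
            (cubeSum-empty n k _ n<k)
  where n<1+k = m<n⇒m<1+n n<k

facetSum : ∀ {n} → Pattern n → (Pattern n → ℕ) → ℕ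
facetSum []            w = 0
facetSum (just b ∷ D)  w = facetSum D (w ∘ (just b ∷_))
facetSum (nothing ∷ D) w = w (just false ∷ D) + w (just true ∷ D) + facetSum D (w ∘ vary)

facetSum-1 : ∀ {n} (D : Pattern n) → facetSum D (λ _ → 1) ≡ 2 * free D
facetSum-1 []            = refl
facetSum-1 (just b ∷ D)  = facetSum-1 D
facetSum-1 (nothing ∷ D) = trans (cong (2 +_) (facetSum-1 D)) (sym (*-suc 2 (free D)))

facetSum-points : ∀ n (w : Pattern n → ℕ) → cubeSum n 0 (λ D → facetSum D w) ≡ 0
facetSum-points zero    w = refl
facetSum-points (suc n) w = cong₂ _+_ (facetSum-points n _) (facetSum-points n _)

cubeSum-∸-step : ∀ n k (w : Pattern n → ℕ) →
                 (n ∸ suc k) * cubeSum n (suc k) w + cubeSum n (suc k) w ≡ (n ∸ k) * cubeSum n (suc k) w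
cubeSum-∸-step n k w with k <? n
... | yes k<n =
  trans (+-comm _ (cubeSum n (suc k) w)) (cong (_* cubeSum n (suc k) w) (sym (+-∸-assoc 1 k<n)))
... | no  k≮n = begin
  (n ∸ suc k) * s + s  ≡⟨ cong (λ x → (n ∸ suc k) * x + x) s≡0 ⟩
  (n ∸ suc k) * 0 + 0  ≡⟨ +-identityʳ _ ⟩
  (n ∸ suc k) * 0      ≡⟨ trans (*-zeroʳ (n ∸ suc k)) (sym (*-zeroʳ (n ∸ k))) ⟩
  (n ∸ k) * 0          ≡⟨ cong ((n ∸ k) *_) s≡0 ⟨
  (n ∸ k) * s          ∎
  where
  open ≡-Reasoning
  s = cubeSum n (suc k) w
  s≡0 : s ≡ 0
  s≡0 = cubeSum-empty n (suc k) w (s≤s (≮⇒≥ k≮n))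

cubeSum-facetSum : ∀ n k (w : Pattern n → ℕ) →
                   cubeSum n (suc k) (λ D → facetSum D w) ≡ (n ∸ k) * cubeSum n k w
cubeSum-facetSum zero    zero    w = refl
cubeSum-facetSum zero    (suc k) w = refl
cubeSum-facetSum (suc n) zero    w = begin
  cubeSum n 1 (λ D → facetSum D w₀) + cubeSum n 1 (λ D → facetSum D w₁)
    + cubeSum n 0 (λ D → w₀ D + w₁ D + facetSum D (w ∘ vary))
    ≡⟨ cong₂ _+_ (cong₂ _+_ (cubeSum-facetSum n 0 w₀) (cubeSum-facetSum n 0 w₁))
                 (trans (cubeSum-+ n 0 (λ D → w₀ D + w₁ D) (λ D → facetSum D (w ∘ vary)))
                        (cong₂ _+_ (cubeSum-+ n 0 w₀ w₁) (facetSum-points n _))) ⟩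
  n * a + n * b + (a + b + 0)
    ≡⟨ regroup n a b ⟩
  suc n * (a + b)  ∎
  where
  open ≡-Reasoning
  w₀ w₁ : Pattern n → ℕ
  w₀ = w ∘ fix₀
  w₁ = w ∘ fix₁
  a b : ℕ
  a = cubeSum n 0 w₀
  b = cubeSum n 0 w₁
  regroup : ∀ n a b → n * a + n * b + (a + b + 0) ≡ suc n * (a + b)
  regroup = solve-∀
cubeSum-facetSum (suc n) (suc k) w = begin
  cubeSum n (2 + k) (λ D → facetSum D w₀) + cubeSum n (2 + k) (λ D → facetSum D w₁)
    + cubeSum n (suc k) (λ D → w₀ D + w₁ D + facetSum D (w ∘ vary))
    ≡⟨ cong₂ _+_ (cong₂ _+_ (cubeSum-facetSum n (suc k) w₀) (cubeSum-facetSum n (suc k) w₁))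
                 (trans (cubeSum-+ n (suc k) (λ D → w₀ D + w₁ D) (λ D → facetSum D (w ∘ vary)))
                        (cong₂ _+_ (cubeSum-+ n (suc k) w₀ w₁) (cubeSum-facetSum n k (w ∘ vary)))) ⟩
  m * a + m * b + (a + b + (n ∸ k) * c)
    ≡⟨ regroup m a b ((n ∸ k) * c) ⟩
  (m * a + a) + (m * b + b) + (n ∸ k) * c
    ≡⟨ cong₂ _+_ (cong₂ _+_ (cubeSum-∸-step n k w₀) (cubeSum-∸-step n k w₁)) refl ⟩
  (n ∸ k) * a + (n ∸ k) * b + (n ∸ k) * c
    ≡⟨ distrib (n ∸ k) a b c ⟩
  (n ∸ k) * (a + b + c)  ∎
  where
  open ≡-Reasoning
  w₀ w₁ : Pattern n → ℕ
  w₀ = w ∘ fix₀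
  w₁ = w ∘ fix₁
  m a b c : ℕ
  m = n ∸ suc k
  a = cubeSum n (suc k) w₀
  b = cubeSum n (suc k) w₁
  c = cubeSum n k (w ∘ vary)
  regroup : ∀ m a b x → m * a + m * b + (a + b + x) ≡ (m * a + a) + (m * b + b) + x
  regroup = solve-∀
  distrib : ∀ l a b c → l * a + l * b + l * c ≡ l * (a + b + c)
  distrib = solve-∀

cubeCount : ℕ → ℕ → ℕ
cubeCount n k = cubeSum n k (λ _ → 1)

binomial-term-doubling : ∀ n k → 2 * ((n C suc k) * 2 ^ (n ∸ suc k)) ≡ (n C suc k) * 2 ^ (n ∸ k)
binomial-term-doubling n k with k <? n
... | yes k<n = begin
  2 * ((n C suc k) * 2 ^ (n ∸ suc k))  ≡⟨ x*[y*z]≡y*[x*z] 2 (n C suc k) (2 ^ (n ∸ suc k)) ⟩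
  (n C suc k) * 2 ^ (1 + (n ∸ suc k))  ≡⟨ cong (λ e → (n C suc k) * 2 ^ e) (+-∸-assoc 1 k<n) ⟨
  (n C suc k) * 2 ^ (n ∸ k)            ∎
  where
  open ≡-Reasoning
  x*[y*z]≡y*[x*z] : ∀ x y z → x * (y * z) ≡ y * (x * z)
  x*[y*z]≡y*[x*z] = solve-∀
... | no k≮n rewrite k>n⇒nCk≡0 (s≤s (≮⇒≥ k≮n)) = refl

cubeCount≡C*2^ : ∀ n k → cubeCount n k ≡ (n C k) * 2 ^ (n ∸ k)
cubeCount≡C*2^ zero    zero    = refl
cubeCount≡C*2^ zero    (suc k) = refl
cubeCount≡C*2^ (suc n) zero    =
  trans (cong₂ _+_ (cubeCount≡C*2^ n zero) (cubeCount≡C*2^ n zero)) (x+x≡1*[2*x] (2 ^ n))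
  where
  x+x≡1*[2*x] : ∀ x → 1 * x + 1 * x ≡ 1 * (2 * x)
  x+x≡1*[2*x] = solve-∀
cubeCount≡C*2^ (suc n) (suc k) = begin
  cubeCount n (suc k) + cubeCount n (suc k) + cubeCount n k
    ≡⟨ cong₂ _+_ (cong₂ _+_ (cubeCount≡C*2^ n (suc k)) (cubeCount≡C*2^ n (suc k)))
                 (cubeCount≡C*2^ n k) ⟩
  x + x + (n C k) * 2 ^ (n ∸ k)
    ≡⟨ cong (_+ (n C k) * 2 ^ (n ∸ k)) (trans (x+x≡2*x x) (binomial-term-doubling n k)) ⟩
  (n C suc k) * 2 ^ (n ∸ k) + (n C k) * 2 ^ (n ∸ k)
    ≡⟨ +-comm ((n C suc k) * 2 ^ (n ∸ k)) _ ⟩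
  (n C k) * 2 ^ (n ∸ k) + (n C suc k) * 2 ^ (n ∸ k)
    ≡⟨ *-distribʳ-+ (2 ^ (n ∸ k)) (n C k) (n C suc k) ⟨
  (n C k + n C suc k) * 2 ^ (n ∸ k)
    ≡⟨ cong (_* 2 ^ (n ∸ k)) (nCk+nC[k+1]≡[n+1]C[k+1] n k) ⟩
  (suc n C suc k) * 2 ^ (n ∸ k)  ∎
  where
  open ≡-Reasoning
  x : ℕ
  x = (n C suc k) * 2 ^ (n ∸ suc k)
  x+x≡2*x : ∀ x → x + x ≡ 2 * x
  x+x≡2*x = solve-∀

indicator : Bool → ℕ
indicator b = if b then 1 else 0

fixedWeight : ∀ {n} → Pattern n → ℕ
fixedWeight []               = 0
fixedWeight (just true ∷ c)  = suc (fixedWeight c)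
fixedWeight (just false ∷ c) = fixedWeight c
fixedWeight (nothing ∷ c)    = fixedWeight c

even : ℕ → Bool
even zero    = true
even (suc m) = not (even m)

evenCubes oddCubes : ℕ → ℕ → ℕ
evenCubes n k = cubeSum n k (indicator ∘ even ∘ fixedWeight)
oddCubes  n k = cubeSum n k (indicator ∘ not ∘ even ∘ fixedWeight)

evenCubes+oddCubes : ∀ n k → evenCubes n k + oddCubes n k ≡ cubeCount n k
evenCubes+oddCubes n k =
  trans (sym (cubeSum-+ n k (indicator ∘ even ∘ fixedWeight) (indicator ∘ not ∘ even ∘ fixedWeight)))
        (cubeSum-cong n k (λ c _ → partition (even (fixedWeight c))))
  where
  partition : ∀ b → indicator b + indicator (not b) ≡ 1
  partition true  = refl
  partition false = refl

evenCubes-not-not : ∀ n k → cubeSum n k (indicator ∘ not ∘ not ∘ even ∘ fixedWeight) ≡ evenCubes n k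
evenCubes-not-not n k =
  cubeSum-cong n k (λ c _ → cong indicator (not-involutive (even (fixedWeight c))))

evenCubes≡oddCubes : ∀ n k → k < n → evenCubes n k ≡ oddCubes n k
evenCubes≡oddCubes (suc n) zero    _         =
  trans (+-comm (evenCubes n 0) (oddCubes n 0)) (cong (oddCubes n 0 +_) (sym (evenCubes-not-not n 0)))
evenCubes≡oddCubes (suc n) (suc k) (s≤s k<n) =
  cong₂ _+_ (trans (+-comm (evenCubes n (suc k)) _)
                   (cong (oddCubes n (suc k) +_) (sym (evenCubes-not-not n (suc k)))))
            (evenCubes≡oddCubes n k k<n)

cubes-free : ∀ n k → All (λ c → free c ≡ k) (cubes n k)
cubes-free zero    zero    = refl ∷ []
cubes-free zero    (suc k) = []
cubes-free (suc n) zero    = All.++⁺ (All.map⁺ (cubes-free n zero)) (All.map⁺ (cubes-free n zero))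
cubes-free (suc n) (suc k) =
  All.++⁺ (All.++⁺ (All.map⁺ (cubes-free n (suc k))) (All.map⁺ (cubes-free n (suc k))))
          (All.map⁺ (All.map (cong suc) (cubes-free n k)))

∈-cubes : ∀ n k (c : Pattern n) → free c ≡ k → c ∈ cubes n k
∈-cubes zero    zero    []               refl = here refl
∈-cubes (suc n) zero    (just false ∷ c) c-k  = ∈-++⁺ˡ (∈-map⁺ fix₀ (∈-cubes n zero c c-k))
∈-cubes (suc n) zero    (just true ∷ c)  c-k  =
  ∈-++⁺ʳ (map fix₀ (cubes n zero)) (∈-map⁺ fix₁ (∈-cubes n zero c c-k))
∈-cubes (suc n) (suc k) (just false ∷ c) c-k  = ∈-++⁺ˡ (∈-++⁺ˡ (∈-map⁺ fix₀ (∈-cubes n (suc k) c c-k)))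
∈-cubes (suc n) (suc k) (just true ∷ c)  c-k  =
  ∈-++⁺ˡ (∈-++⁺ʳ (map fix₀ (cubes n (suc k))) (∈-map⁺ fix₁ (∈-cubes n (suc k) c c-k)))
∈-cubes (suc n) (suc k) (nothing ∷ c)    c-k  =
  ∈-++⁺ʳ (map fix₀ (cubes n (suc k)) ++ map fix₁ (cubes n (suc k)))
         (∈-map⁺ vary (∈-cubes n k c (suc-injective c-k)))

disjoint-by : ∀ {A : Set} {P : A → Set} {xs ys : List A} →
              All P xs → All (¬_ ∘ P) ys → Disjoint xs ys
disjoint-by pxs ¬pys (v∈xs , v∈ys) = All.lookup ¬pys v∈ys (All.lookup pxs v∈xs)

fixedFirst-Unique : ∀ {n} {cs : List (Pattern n)} → Unique cs → Unique (map fix₀ cs ++ map fix₁ cs)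
fixedFirst-Unique u = Unique.++⁺ (Unique.map⁺ ∷-injectiveʳ u) (Unique.map⁺ ∷-injectiveʳ u)
  (disjoint-by {P = λ c → head c ≡ just false}
               (All.map⁺ {f = fix₀} (All.universal (λ _ → refl) _))
                                              (All.map⁺ {f = fix₁} (All.universal (λ _ ()) _)))

cubes-Unique : ∀ n k → Unique (cubes n k)
cubes-Unique zero    zero    = [] AllPairs.∷ AllPairs.[]
cubes-Unique zero    (suc k) = AllPairs.[]
cubes-Unique (suc n) zero    = fixedFirst-Unique (cubes-Unique n zero)
cubes-Unique (suc n) (suc k) = Unique.++⁺ (fixedFirst-Unique (cubes-Unique n (suc k)))
  (Unique.map⁺ ∷-injectiveʳ (cubes-Unique n k))
  (disjoint-by {P = λ c → head c ≢ nothing}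
     (All.++⁺ (All.map⁺ {f = fix₀} (All.universal (λ _ ()) (cubes n (suc k))))
              (All.map⁺ {f = fix₁} (All.universal (λ _ ()) (cubes n (suc k)))))
     (All.map⁺ {f = vary} (All.universal (λ _ fixed → fixed refl) _)))

sum-map-++ : ∀ {A : Set} (w : A → ℕ) xs ys →
             sum (map w (xs ++ ys)) ≡ sum (map w xs) + sum (map w ys)
sum-map-++ w xs ys = trans (cong sum (map-++ w xs ys)) (sum-++ (map w xs) (map w ys))

sum-map-∘ : ∀ {A B : Set} (w : B → ℕ) (f : A → B) xs →
            sum (map w (map f xs)) ≡ sum (map (w ∘ f) xs)
sum-map-∘ w f xs = cong sum (sym (map-∘ xs))

sum-map-cubes : ∀ n k (w : Pattern n → ℕ) → sum (map w (cubes n k)) ≡ cubeSum n k w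
sum-map-cubes zero    zero    w = +-identityʳ (w [])
sum-map-cubes zero    (suc k) w = refl
sum-map-cubes (suc n) zero    w =
  trans (sum-map-++ w (map fix₀ (cubes n zero)) (map fix₁ (cubes n zero)))
        (cong₂ _+_ (trans (sum-map-∘ w fix₀ (cubes n zero)) (sum-map-cubes n zero _))
                   (trans (sum-map-∘ w fix₁ (cubes n zero)) (sum-map-cubes n zero _)))
sum-map-cubes (suc n) (suc k) w =
  trans (sum-map-++ w (map fix₀ (cubes n (suc k)) ++ map fix₁ (cubes n (suc k)))
                      (map vary (cubes n k)))
        (cong₂ _+_ (trans (sum-map-++ w (map fix₀ (cubes n (suc k))) (map fix₁ (cubes n (suc k))))
                          (cong₂ _+_ (trans (sum-map-∘ w fix₀ (cubes n (suc k))) (sum-map-cubes n (suc k) _))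
                                     (trans (sum-map-∘ w fix₁ (cubes n (suc k))) (sum-map-cubes n (suc k) _))))
                   (trans (sum-map-∘ w vary (cubes n k)) (sum-map-cubes n k _)))

-- Λ as a count of star cubes

starIndicator : (List Bool → Bool) → ℕ
starIndicator h = indicator (isStar (h ∘ toList))

starCount : ∀ {n} → Subset n → Pattern n → ℕ
starCount S c = starIndicator (S ∘ fill c)

ΛIs-unique : ∀ {d n} {H : Subset d} {S : Subset n} {k k′} → ΛIs H S k → ΛIs H S k′ → k ≡ k′
ΛIs-unique (L , L-unique , ∈L⇔ , refl) (L′ , L′-unique , ∈L′⇔ , refl) =
  ↭-length (∼bag⇒↭ (unique∧set⇒bag L-unique L′-unique λ {c} →
    mk⇔ (Equivalence.from (∈L′⇔ c) ∘ Equivalence.to (∈L⇔ c))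
        (Equivalence.from (∈L⇔ c) ∘ Equivalence.to (∈L′⇔ c))))

starCubes : ∀ {n} → Subset n → List (Pattern n)
starCubes {n} S = filter (λ c → isStar (restrict S c) ≟ᵇ true) (cubes n 3)

ΛIs-starCubes : ∀ {n} (S : Subset n) → ΛIs W12 S (length (starCubes S))
ΛIs-starCubes {n} S =
  starCubes S , Unique.filter⁺ star? (cubes-Unique n 3) , (λ c → mk⇔ (to c) (from c)) , refl
  where
  star? = λ c → isStar (restrict S c) ≟ᵇ true
  to : ∀ c → c ∈ starCubes S → GivesCopy W12 S c
  to c c∈ = let c∈cubes , star = ∈-filter⁻ star? c∈
            in Equivalence.from GivesCopy-W12⇔ (All.lookup (cubes-free n 3) c∈cubes , star)
  from : ∀ c → GivesCopy W12 S c → c ∈ starCubes S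
  from c copy = let c-3 , star = Equivalence.to GivesCopy-W12⇔ copy
                in ∈-filter⁺ star? (∈-cubes n 3 c c-3) star

length-filter-≡true : ∀ {A : Set} (p : A → Bool) xs →
                      length (filter (λ x → p x ≟ᵇ true) xs) ≡ sum (map (indicator ∘ p) xs)
length-filter-≡true p []       = refl
length-filter-≡true p (x ∷ xs) with p x
... | true  = cong suc (length-filter-≡true p xs)
... | false = length-filter-≡true p xs

length-starCubes : ∀ {n} (S : Subset n) → length (starCubes S) ≡ cubeSum n 3 (starCount S)
length-starCubes {n} S =
  trans (length-filter-≡true (isStar ∘ restrict S) (cubes n 3)) (sum-map-cubes n 3 (starCount S))

-- The upper bound

-- The facets of Q_m, each given by the map inserting its fixed coordinate into a coordinate list.
insertionSum : ℕ → ((List Bool → List Bool) → ℕ) → ℕ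
insertionSum zero    G = 0
insertionSum (suc m) G =
  G (false ∷_) + G (true ∷_) + insertionSum m (λ ins → G (λ xs → headᶠ xs ∷ ins (drop 1 xs)))

-- The facets of D, in their own coordinates, are the facets of Q_{free D} in the coordinates of D.
facetSum-fill : ∀ {n} (D : Pattern n) (Ψ : (List Bool → Bool) → ℕ)
                (S : List Bool → Vertex n → Bool) (σ : List Bool → List Bool) →
                facetSum D (λ c → Ψ (λ xs → S xs (fill c (σ xs))))
                  ≡ insertionSum (free D) (λ ins → Ψ (λ xs → S xs (fill D (ins (σ xs)))))
facetSum-fill []            Ψ S σ = refl
facetSum-fill (just b ∷ D)  Ψ S σ = facetSum-fill D Ψ (λ xs → S xs ∘ (b ∷_)) σ
facetSum-fill (nothing ∷ D) Ψ S σ =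
  cong (Ψ (λ xs → S xs (false ∷ fill D (σ xs))) + Ψ (λ xs → S xs (true ∷ fill D (σ xs))) +_)
       (facetSum-fill D Ψ (λ xs → S xs ∘ (headᶠ (σ xs) ∷_)) (drop 1 ∘ σ))

starFacets : (List Bool → Bool) → ℕ
starFacets h = insertionSum 4 (λ ins → starIndicator (h ∘ ins))

-- Checked on all 2¹⁶ subsets of Q₄, in the same way as centreCorrect-all.
starFacets≤4 : ∀ h → starFacets h ≤ 4
starFacets≤4 h = ≤ᵇ⇒≤ (starFacets h) 4 (Equivalence.from T-≡
  (allTables-sound 4 {λ t → starFacets (lookupᵀ t ∘ toVertex 4) ≤ᵇ 4} refl (tabulate (h ∘ toList))))

facetStars-≤-half : ∀ {n} (S : Subset n) (D : Pattern n) → IsSubcube 4 D →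
                   2 * facetSum D (starCount S) ≤ facetSum D (λ _ → 1)
facetStars-≤-half S D D-4 = begin
  2 * facetSum D (starCount S)  ≡⟨ cong (2 *_) (facetSum-fill D starIndicator (λ _ → S) id) ⟩
  2 * starsOnFacets (free D)    ≡⟨ cong (λ m → 2 * starsOnFacets m) D-4 ⟩
  2 * starFacets (S ∘ fill D)   ≤⟨ *-monoʳ-≤ 2 (starFacets≤4 (S ∘ fill D)) ⟩
  8                             ≡⟨ trans (facetSum-1 D) (cong (2 *_) D-4) ⟨
  facetSum D (λ _ → 1)          ∎
  where
  open ≤-Reasoning
  starsOnFacets : ℕ → ℕ
  starsOnFacets m = insertionSum m (λ ins → starIndicator (S ∘ fill D ∘ ins))

cubeCount≡2*evenCubes : ∀ n k → k < n → cubeCount n k ≡ 2 * evenCubes n k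
cubeCount≡2*evenCubes n k k<n = begin
  cubeCount n k                    ≡⟨ evenCubes+oddCubes n k ⟨
  evenCubes n k + oddCubes n k     ≡⟨ cong (evenCubes n k +_) (evenCubes≡oddCubes n k k<n) ⟨
  evenCubes n k + evenCubes n k    ≡⟨ cong (evenCubes n k +_) (+-identityʳ (evenCubes n k)) ⟨
  2 * evenCubes n k                ∎
  where open ≡-Reasoning

cubeSum-starCount≤evenCubes : ∀ {n} (S : Subset n) → 3 < n → cubeSum n 3 (starCount S) ≤ evenCubes n 3
cubeSum-starCount≤evenCubes {n} S 3<n =
  *-cancelˡ-≤ 2 (*-cancelˡ-≤ (n ∸ 3) {{>-nonZero (m<n⇒0<n∸m 3<n)}} (begin
    (n ∸ 3) * (2 * A)                         ≡⟨ x*[y*z]≡y*[x*z] (n ∸ 3) 2 A ⟩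
    2 * ((n ∸ 3) * A)                         ≡⟨ cong (2 *_) (cubeSum-facetSum n 3 (starCount S)) ⟨
    2 * cubeSum n 4 facetSums                 ≡⟨ cubeSum-* n 4 2 facetSums ⟨
    cubeSum n 4 (λ D → 2 * facetSums D)       ≤⟨ cubeSum-mono n 4 (facetStars-≤-half S) ⟩
    cubeSum n 4 (λ D → facetSum D (λ _ → 1))  ≡⟨ cubeSum-facetSum n 3 (λ _ → 1) ⟩
    (n ∸ 3) * cubeCount n 3                   ≡⟨ cong ((n ∸ 3) *_) (cubeCount≡2*evenCubes n 3 3<n) ⟩
    (n ∸ 3) * (2 * evenCubes n 3)             ∎))
  where
  open ≤-Reasoning
  A : ℕ
  A = cubeSum n 3 (starCount S)
  facetSums : Pattern n → ℕ
  facetSums D = facetSum D (starCount S)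
  x*[y*z]≡y*[x*z] : ∀ x y z → x * (y * z) ≡ y * (x * z)
  x*[y*z]≡y*[x*z] = solve-∀

Λ≤evenCubes : ∀ {n} (S : Subset n) k → 3 < n → ΛIs W12 S k → k ≤ evenCubes n 3
Λ≤evenCubes {n} S k 3<n Λ≡k =
  subst (_≤ evenCubes n 3) (trans (sym (length-starCubes S)) (ΛIs-unique (ΛIs-starCubes S) Λ≡k))
        (cubeSum-starCount≤evenCubes S 3<n)

-- The extremal set

weight : ∀ {n} → Vertex n → ℕ
weight []          = 0
weight (true ∷ x)  = suc (weight x)
weight (false ∷ x) = weight x

S₀ : ∀ {n} → Subset n
S₀ x = weight x % 4 ≤ᵇ 1

weight-embed : ∀ {n d} (c : Pattern n) → IsSubcube d c → (x : Vertex d) →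
               weight (embed c x) ≡ fixedWeight c + weight x
weight-embed c refl = go c
  where
  go : ∀ {n} (c : Pattern n) (x : Vertex (free c)) → weight (embed c x) ≡ fixedWeight c + weight x
  go []               []          = refl
  go (just true ∷ c)  x           = cong suc (go c x)
  go (just false ∷ c) x           = go c x
  go (nothing ∷ c)    (true ∷ x)  = trans (cong suc (go c x)) (sym (+-suc (fixedWeight c) (weight x)))
  go (nothing ∷ c)    (false ∷ x) = go c x

-- For even m the window selects the weights {0,1} or {2,3} of Q₃, i.e. the stars at 000 and 111.
isStar-window : ∀ m → isStar (λ p → (m + weight p) % 4 ≤ᵇ 1) ≡ even m
isStar-window 0 = refl
isStar-window 1 = refl
isStar-window 2 = refl
isStar-window 3 = refl
isStar-window (suc (suc (suc (suc m)))) = begin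
  isStar (λ p → (4 + m + weight p) % 4 ≤ᵇ 1)
    ≡⟨ isStar-cong (λ p → cong (_≤ᵇ 1) (shift (m + weight p))) ⟩
  isStar (λ p → (m + weight p) % 4 ≤ᵇ 1)
    ≡⟨ isStar-window m ⟩
  even m
    ≡⟨ trans (not-involutive _) (not-involutive _) ⟨
  even (4 + m) ∎
  where
  open ≡-Reasoning
  shift : ∀ k → (4 + k) % 4 ≡ k % 4
  shift k = trans (cong (_% 4) (+-comm 4 k)) ([m+n]%n≡m%n k 4)

starCount-S₀ : ∀ {n} (c : Pattern n) → IsSubcube 3 c → starCount S₀ c ≡ indicator (even (fixedWeight c))
starCount-S₀ c c-3 = cong indicator (begin
  isStar (restrict S₀ c)
    ≡⟨ isStar-cong (λ p → cong (λ w → w % 4 ≤ᵇ 1) (weight-embed c c-3 p)) ⟩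
  isStar (λ p → (fixedWeight c + weight p) % 4 ≤ᵇ 1)
    ≡⟨ isStar-window (fixedWeight c) ⟩
  even (fixedWeight c) ∎)
  where open ≡-Reasoning

ΛIs-S₀ : ∀ n → ΛIs W12 (S₀ {n}) (evenCubes n 3)
ΛIs-S₀ n =
  subst (ΛIs W12 S₀) (trans (length-starCubes (S₀ {n})) (cubeSum-cong n 3 starCount-S₀)) (ΛIs-starCubes S₀)

ΛmaxIs-W12-3 : ΛmaxIs W12 3 1
ΛmaxIs-W12-3 = bound , W12 , ΛIs-starCubes W12
  where
  bound : ∀ S k → ΛIs W12 S k → k ≤ 1
  bound S k Λ≡k = subst (_≤ 1) (ΛIs-unique (ΛIs-starCubes S) Λ≡k)
                        (length-filter (λ c → isStar (restrict S c) ≟ᵇ true) (cubes 3 3))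

ΛmaxIs-W12 : ∀ n → 3 < n → ΛmaxIs W12 n (evenCubes n 3)
ΛmaxIs-W12 n 3<n = (λ S k → Λ≤evenCubes S k 3<n) , S₀ , ΛIs-S₀ n

theorem1p2 : ΛmaxIs W12 3 1
    × (∀ (n : ℕ) → 4 ≤ n → Σ ℕ λ v → (2 * v ≡ (n C 3) * 2 ^ (n ∸ 3)) × ΛmaxIs W12 n v)
theorem1p2 = ΛmaxIs-W12-3 , λ n 3<n →
  evenCubes n 3 , trans (sym (cubeCount≡2*evenCubes n 3 3<n)) (cubeCount≡C*2^ n 3) , ΛmaxIs-W12 n 3<n
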